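{- For every positive integer $n$, there is a tree $T$ of order $n$ such that $\mathrm{conv}^{\leq 4}(T) \geq \left\lceil \frac{3n-4}{8}\right\rceil$.
   Context: In an oriented graph, the inversion of a vertex set $X$ reverses the orientation of every arc with both endvertices in $X$; a $(\leq p)$-inversion is the inversion of a set of at most $p$ vertices. For a graph $G$, $\mathrm{conv}^{\leq p}(G)$ is the minimum number of $(\leq p)$-inversions transforming an orientation of $G$ into its converse (all arcs reversed); this does not depend on the chosen orientation. -}

module Defs where

open import Data.Nat using (ℕ; _≤_; _+_; _*_; _∸_)
open import Data.Nat.DivMod using (_/_)
open import Data.Bool using (Bool; true; false; _∧_; if_then_else_; T)
open import Data.Fin using (Fin)
open import Data.Fin.Subset using (Subset; ∣_∣)
open import Data.Vec using (lookup)
open import Data.List using (List; []; _∷_; _++_; [_]; length; foldr)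
open import Data.List.Relation.Unary.All using (All)
open import Data.List.Relation.Unary.Unique.Propositional using (Unique)
open import Data.Product using (_×_; ∃)
open import Data.Sum using (_⊎_)
open import Data.Unit using (⊤)
open import Relation.Nullary using (¬_)
open import Relation.Binary.PropositionalEquality using (_≡_)

record Graph (n : ℕ) : Set where
  field
    adj   : Fin n → Fin n → Bool
    sym   : ∀ u v → adj u v ≡ adj v u
    loopless : ∀ u → adj u u ≡ false
open Graph public

Consec : ∀ {n} → Graph n → List (Fin n) → Set
Consec G [] = ⊤
Consec G (x ∷ []) = ⊤
Consec G (x ∷ y ∷ xs) = T (adj G x y) × Consec G (y ∷ xs)

Connected : ∀ {n} → Graph n → Set
Connected {n} G = ∀ (u v : Fin n) → u ≡ v ⊎ ∃ λ ws → Consec G (u ∷ ws ++ [ v ])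

HasCycle : ∀ {n} → Graph n → Set
HasCycle {n} G = ∃ λ (v : Fin n) → ∃ λ ws →
  2 ≤ length ws × Unique (v ∷ ws) × Consec G (v ∷ ws ++ [ v ])

Acyclic : ∀ {n} → Graph n → Set
Acyclic G = ¬ HasCycle G

IsTree : ∀ {n} → Graph n → Set
IsTree G = Connected G × Acyclic G

Digraph : ℕ → Set
Digraph n = Fin n → Fin n → Bool

IsOrientation : ∀ {n} → Graph n → Digraph n → Set
IsOrientation {n} G D = ∀ (u v : Fin n) →
  (T (D u v) → T (adj G u v)) × (T (adj G u v) → T (D u v) ⊎ T (D v u)) × ¬ (T (D u v) × T (D v u))

invert : ∀ {n} → Subset n → Digraph n → Digraph n
invert X D u v = if lookup X u ∧ lookup X v then D v u else D u v

invertAll : ∀ {n} → List (Subset n) → Digraph n → Digraph n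
invertAll Xs D = foldr invert D Xs

converse : ∀ {n} → Digraph n → Digraph n
converse D u v = D v u

ConvAtLeast : ℕ → ∀ {n} → Graph n → ℕ → Set
ConvAtLeast p {n} G k = ∀ (D : Digraph n) → IsOrientation G D →
  ∀ (Xs : List (Subset n)) → All (λ X → ∣ X ∣ ≤ p) Xs →
  (∀ u v → invertAll Xs D u v ≡ converse D u v) → k ≤ length Xs

-- ⌈(3n-4)/8⌉ for n ≥ 1 (for n = 1 the value is ⌈-1/8⌉ = 0)
bound : ℕ → ℕ
bound n = (3 * n ∸ 4 + 7) / 8

{-# OPTIONS --safe #-}

-- Take the spider whose legs have length 2 (plus one leg of length 1 when n is even).  Every edge
-- changes direction, so it lies inside some inverted set.  Weigh the edges at the centre 1 and the
-- outer edges 2: a set of at most 4 vertices contains edges of weight at most 4 (the centre, one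
-- whole leg and one more neighbour of the centre), while all edges together weigh at least
-- (3n − 4)/2, so at least (3n − 4)/8 inversions are needed.  The spider is a tree because every
-- vertex has at most one neighbour with a smaller label: along a path, labels that start rising
-- keep rising and labels that end falling were falling throughout, so no path closes to a cycle.

module Submission where

open import Defs
open import Data.Nat using (ℕ; _≤_)
open import Data.Product using (Σ; _×_)

open import Data.Bool using (Bool; true; false; _∧_; _∨_; T; if_then_else_)
open import Data.Bool.Properties using (∨-comm; T-∨)
open import Data.Empty using (⊥; ⊥-elim)
open import Data.Fin using (Fin; zero; suc; _<_; _>_; _≟_)
open import Data.Fin.Induction using (<-wellFounded)
open import Data.Fin.Properties using (<-cmp; <-asym; <-irrefl; <-trans)
open import Data.Fin.Subset using (Subset; ∣_∣)
open import Data.List using (List; []; _∷_; _++_; [_]; _∷ʳ_; length; map; initLast; _∷ʳ′_)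
open import Data.List.Properties using (++-assoc; map-∘)
open import Data.List.Relation.Unary.All as All using (All; []; _∷_)
open import Data.List.Relation.Unary.All.Properties using (∷ʳ⁻)
open import Data.List.Relation.Unary.AllPairs as AllPairs using ([]; _∷_)
open import Data.List.Relation.Unary.AllPairs.Properties using (++⁺)
open import Data.List.Relation.Unary.Any as Any using (Any; here; there)
import Data.List.Relation.Unary.Any.Properties as Any
open import Data.List.Relation.Unary.Linked as Linked using (Linked; []; [-]; _∷_)
open import Data.List.Relation.Unary.Linked.Properties using (Linked⇒AllPairs)
open import Data.List.Relation.Unary.Unique.Propositional using (Unique)
open import Data.Nat using (zero; suc; _+_; _*_; _∸_; z≤n; s≤s; z<s; s<s)
open import Data.Nat.DivMod using (_/_; m<n*o⇒m/o<n)
open import Data.Nat.ListAction using (sum)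
open import Data.Nat.Properties
  using ( +-commutativeSemigroup; ≤-refl; ≤-trans; ≤-pred; m≤m+n; m≤n+m; m≤n⇒m≤1+n; n≤1+n; n<1+n
        ; +-comm; +-mono-≤; +-monoʳ-≤; +-mono-<-≤; *-monoʳ-≤; *-distribˡ-+; *-cancelˡ-<
        ; m≤n+o⇒m∸n≤o; module ≤-Reasoning )
open import Data.Nat.Tactic.RingSolver using (solve-∀)
open import Algebra.Properties.CommutativeSemigroup +-commutativeSemigroup using (interchange)
open import Data.Product using (_,_; ∃; proj₁; proj₂)
open import Data.Sum using (_⊎_; inj₁; inj₂)
open import Data.Unit using (tt)
open import Data.Vec using ([]; _∷_; lookup)
open import Function.Base using (_∘_; flip)
open import Function.Bundles using (Equivalence)
import Induction.WellFounded as WF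
open import Level using (0ℓ)
open import Relation.Binary.Definitions using (Transitive; tri<; tri≈; tri>)
open import Relation.Binary.PropositionalEquality as ≡
  using (_≡_; _≢_; ≢-sym; refl; subst; cong; cong₂)
open import Relation.Nullary using (¬_; does; yes; no)

-- A record rather than T (adj G u v), so that the endpoints can be inferred.
record Adjacent {n} (G : Graph n) (u v : Fin n) : Set where
  constructor adjacent
  field edge : T (adj G u v)

module _ {n} (G : Graph n) where

  Walk : List (Fin n) → Set
  Walk = Linked (Adjacent G)

  adjacent-sym : ∀ {u v} → Adjacent G u v → Adjacent G v u
  adjacent-sym {u} {v} (adjacent e) = adjacent (subst T (sym G u v) e)

  adjacent⇒≢ : ∀ {u v} → Adjacent G u v → u ≢ v
  adjacent⇒≢ {u} (adjacent e) refl = subst T (loopless G u) e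

  adjacent⇒<⊎> : ∀ {u v} → Adjacent G u v → u < v ⊎ v < u
  adjacent⇒<⊎> {u} {v} a with <-cmp u v
  ... | tri< u<v _ _ = inj₁ u<v
  ... | tri≈ _ u≡v _ = ⊥-elim (adjacent⇒≢ a u≡v)
  ... | tri> _ _ v<u = inj₂ v<u

  Consec⇒Walk : ∀ {xs} → Consec G xs → Walk xs
  Consec⇒Walk {[]}        _       = []
  Consec⇒Walk {_ ∷ []}    _       = [-]
  Consec⇒Walk {_ ∷ _ ∷ _} (e , c) = adjacent e ∷ Consec⇒Walk c

  Consec-++ : ∀ xs {v} ys → Consec G (xs ++ [ v ]) → Consec G (v ∷ ys) → Consec G (xs ++ v ∷ ys)
  Consec-++ []           ys _       c = c
  Consec-++ (_ ∷ [])     ys (e , _) c = e , c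
  Consec-++ (_ ∷ x ∷ xs) ys (e , c) d = e , Consec-++ (x ∷ xs) ys c d

  Reachable : Fin n → Fin n → Set
  Reachable u v = u ≡ v ⊎ ∃ λ ws → Consec G (u ∷ ws ++ [ v ])

  adjacent⇒reachable : ∀ {u v} → Adjacent G u v → Reachable u v
  adjacent⇒reachable (adjacent e) = inj₂ ([] , e , tt)

  reachable-trans : ∀ {u v w} → Reachable u v → Reachable v w → Reachable u w
  reachable-trans (inj₁ refl) r = r
  reachable-trans r (inj₁ refl) = r
  reachable-trans {u} {v} {w} (inj₂ (ws , c)) (inj₂ (ws′ , d)) =
    inj₂ (ws ++ v ∷ ws′ , subst (λ l → Consec G (u ∷ l)) (≡.sym (++-assoc ws (v ∷ ws′) [ w ]))
                                 (Consec-++ (u ∷ ws) (ws′ ++ [ w ]) c d))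

  AtMostOneSmallerNeighbour : Set
  AtMostOneSmallerNeighbour = ∀ {u w v} → Adjacent G u v → Adjacent G w v → u < v → w < v → u ≡ w

Linked-last : ∀ {A : Set} {R : A → A → Set} xs {a b} → Linked R ((xs ∷ʳ a) ∷ʳ b) → R a b
Linked-last []           (r ∷ _)  = r
Linked-last (_ ∷ [])     (_ ∷ rs) = Linked.head rs
Linked-last (_ ∷ y ∷ xs) (_ ∷ rs) = Linked-last (y ∷ xs) rs

Linked-first-last : ∀ {A : Set} {R : A → A → Set} → Transitive R →
                    ∀ {x b} xs → Linked R (x ∷ xs ∷ʳ b) → R x b
Linked-first-last trans xs r = proj₂ (∷ʳ⁻ {xs = xs} (AllPairs.head (Linked⇒AllPairs trans r)))

Unique-∷ʳ : ∀ {A : Set} {v : A} {xs} → Unique (v ∷ xs) → Unique (xs ∷ʳ v)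
Unique-∷ʳ (v∉xs ∷ xs!) = ++⁺ xs! ([] ∷ []) (All.map (λ v≢x → ≢-sym v≢x ∷ []) v∉xs)

module _ {n} (G : Graph n) (smaller-unique : AtMostOneSmallerNeighbour G) where

  keeps-rising : ∀ {x y z} → Adjacent G x y → Adjacent G y z → x ≢ z → x < y → y < z
  keeps-rising xy yz x≢z x<y with adjacent⇒<⊎> G yz
  ... | inj₁ y<z = y<z
  ... | inj₂ z<y = ⊥-elim (x≢z (smaller-unique xy (adjacent-sym G yz) x<y z<y))

  rising : ∀ {x y} zs → Unique (x ∷ y ∷ zs) → Walk G (x ∷ y ∷ zs) → x < y → Linked _<_ (x ∷ y ∷ zs)
  rising []       _                    _                x<y = x<y ∷ [-]
  rising (_ ∷ zs) ((_ ∷ x≢z ∷ _) ∷ u) (xy ∷ w@(yz ∷ _)) x<y =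
    x<y ∷ rising zs u w (keeps-rising xy yz x≢z x<y)

  falls-first : ∀ {x y} zs → Unique (x ∷ y ∷ zs) → Walk G (x ∷ y ∷ zs) →
                ¬ Linked _<_ (x ∷ y ∷ zs) → y < x
  falls-first zs u w@(xy ∷ _) not-rising with adjacent⇒<⊎> G xy
  ... | inj₁ x<y = ⊥-elim (not-rising (rising zs u w x<y))
  ... | inj₂ y<x = y<x

  falling : ∀ xs {a b} → Unique ((xs ∷ʳ a) ∷ʳ b) → Walk G ((xs ∷ʳ a) ∷ʳ b) → b < a →
            Linked _>_ ((xs ∷ʳ a) ∷ʳ b)
  falling []           _          _          b<a = b<a ∷ [-]
  falling (x ∷ [])     u@(_ ∷ u′) w@(_ ∷ w′) b<a =
    falls-first _ u w (<-asym b<a ∘ Linked-last (x ∷ [])) ∷ falling [] u′ w′ b<a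
  falling (x ∷ y ∷ xs) u@(_ ∷ u′) w@(_ ∷ w′) b<a =
    falls-first _ u w (<-asym b<a ∘ Linked-last (x ∷ y ∷ xs)) ∷ falling (y ∷ xs) u′ w′ b<a

  path-unclosable-last<first : ∀ {x y b} zs → Unique (x ∷ y ∷ zs ++ [ b ]) →
                               Walk G (x ∷ y ∷ zs ++ [ b ]) → Adjacent G b x → b < x → ⊥
  path-unclosable-last<first {y = y} zs u@(_ ∷ y∉ ∷ _) w@(xy ∷ _) bx b<x with adjacent⇒<⊎> G xy
  ... | inj₁ x<y = <-asym b<x (Linked-first-last <-trans (y ∷ zs) (rising _ u w x<y))
  ... | inj₂ y<x = proj₂ (∷ʳ⁻ y∉) (smaller-unique (adjacent-sym G xy) bx y<x b<x)

  path-unclosable-first<last : ∀ {x a b} xs → Unique (x ∷ (xs ∷ʳ a) ∷ʳ b) →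
                               Walk G (x ∷ (xs ∷ʳ a) ∷ʳ b) → Adjacent G b x → x < b → ⊥
  path-unclosable-first<last xs u@(x∉ ∷ _) w bx x<b with adjacent⇒<⊎> G (Linked-last (_ ∷ xs) w)
  ... | inj₁ a<b = proj₂ (∷ʳ⁻ (proj₁ (∷ʳ⁻ x∉)))
                         (smaller-unique (adjacent-sym G bx) (Linked-last (_ ∷ xs) w) x<b a<b)
  ... | inj₂ b<a = <-asym x<b (Linked-first-last (flip <-trans) (xs ∷ʳ _) (falling (_ ∷ xs) u w b<a))

  path-unclosable : ∀ {x y b} zs → Unique (x ∷ y ∷ zs ++ [ b ]) → Walk G (x ∷ y ∷ zs ++ [ b ]) →
                    ¬ Adjacent G b x
  path-unclosable zs u w bx with adjacent⇒<⊎> G bx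
  ... | inj₁ b<x = path-unclosable-last<first zs u w bx b<x
  ... | inj₂ x<b with initLast zs
  ...   | []       = path-unclosable-first<last [] u w bx x<b
  ...   | us ∷ʳ′ _ = path-unclosable-first<last (_ ∷ us) u w bx x<b

  acyclic : Acyclic G
  acyclic (_ , []          , ()     , _)
  acyclic (_ , _ ∷ []      , s≤s () , _)
  acyclic (_ , _ ∷ _ ∷ ws , _ , unique , closed) =
    path-unclosable ws (Unique-∷ʳ unique) (Linked.tail (Consec⇒Walk G closed)) (adjacent (proj₁ closed))

module RecursiveTree {m} (parent : Fin m → Fin (suc m)) (parent<child : ∀ j → parent j < suc j) where

  isParentOf : Fin (suc m) → Fin (suc m) → Bool
  isParentOf u zero    = false
  isParentOf u (suc j) = does (parent j ≟ u)

  isParentOf⇒ : ∀ {u v} → T (isParentOf u v) → ∃ λ j → v ≡ suc j × parent j ≡ u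
  isParentOf⇒ {u} {suc j} t with parent j ≟ u
  ... | yes p = j , refl , p

  isParentOf-parent : ∀ j → T (isParentOf (parent j) (suc j))
  isParentOf-parent j with parent j ≟ parent j
  ... | yes _  = tt
  ... | no p≢p = p≢p refl

  isParentOf⇒< : ∀ {u v} → T (isParentOf u v) → u < v
  isParentOf⇒< {u} {v} t with isParentOf⇒ {u} {v} t
  ... | j , refl , refl = parent<child j

  isParentOf-irrefl : ∀ u → isParentOf u u ≡ false
  isParentOf-irrefl zero    = refl
  isParentOf-irrefl (suc j) with parent j ≟ suc j
  ... | yes p = ⊥-elim (<-irrefl p (parent<child j))
  ... | no _  = refl

  tree : Graph (suc m)
  tree = record
    { adj      = λ u v → isParentOf u v ∨ isParentOf v u
    ; sym      = λ u v → ∨-comm (isParentOf u v) (isParentOf v u)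
    ; loopless = λ u → cong (λ b → b ∨ b) (isParentOf-irrefl u)
    }

  parent-adjacent : ∀ j → Adjacent tree (parent j) (suc j)
  parent-adjacent j = adjacent (Equivalence.from T-∨ (inj₁ (isParentOf-parent j)))

  smaller-neighbour-is-parent : ∀ {u v} → Adjacent tree u v → u < v → ∃ λ j → v ≡ suc j × parent j ≡ u
  smaller-neighbour-is-parent {u} {v} (adjacent e) u<v with Equivalence.to T-∨ e
  ... | inj₁ t = isParentOf⇒ {u} {v} t
  ... | inj₂ t = ⊥-elim (<-asym u<v (isParentOf⇒< {v} {u} t))

  atMostOneSmallerNeighbour : AtMostOneSmallerNeighbour tree
  atMostOneSmallerNeighbour uv wv u<v w<v
    with smaller-neighbour-is-parent uv u<v | smaller-neighbour-is-parent wv w<v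
  ... | _ , refl , refl | _ , refl , refl = refl

  reachable-root : ∀ v → Reachable tree v zero × Reachable tree zero v
  reachable-root = WF.All.wfRec <-wellFounded 0ℓ _ step
    where
    step : ∀ v → (∀ {u} → u < v → Reachable tree u zero × Reachable tree zero u) →
           Reachable tree v zero × Reachable tree zero v
    step zero    _  = inj₁ refl , inj₁ refl
    step (suc j) ih with ih (parent<child j)
    ... | up , down =
      reachable-trans tree (adjacent⇒reachable tree (adjacent-sym tree (parent-adjacent j))) up ,
      reachable-trans tree down (adjacent⇒reachable tree (parent-adjacent j))

  isTree : IsTree tree
  isTree = (λ u v → reachable-trans tree (proj₁ (reachable-root u)) (proj₂ (reachable-root v))) ,
           acyclic tree atMostOneSmallerNeighbour

covers : ∀ {n} → Subset n → Fin n → Fin n → Bool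
covers X u v = lookup X u ∧ lookup X v

changed⇒covered : ∀ {n} (D : Digraph n) Xs {u v} → invertAll Xs D u v ≢ D u v →
                  Any (λ X → T (covers X u v)) Xs
changed⇒covered D []       changed = ⊥-elim (changed refl)
changed⇒covered D (X ∷ Xs) {u} {v} changed with covers X u v in uv∈X
... | true  = here (subst T (≡.sym uv∈X) tt)
... | false = there (changed⇒covered D Xs changed)

orientation-asym : ∀ {n} {G : Graph n} {D : Digraph n} → IsOrientation G D →
                   ∀ {u v} → Adjacent G u v → D u v ≢ D v u
orientation-asym orients {u} {v} (adjacent e) Duv≡Dvu with proj₁ (proj₂ (orients u v)) e
... | inj₁ t = proj₂ (proj₂ (orients u v)) (t , subst T Duv≡Dvu t)
... | inj₂ t = proj₂ (proj₂ (orients u v)) (subst T (≡.sym Duv≡Dvu) t , t)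

edge-covered : ∀ {n} {G : Graph n} {D : Digraph n} → IsOrientation G D →
               ∀ Xs → (∀ u v → invertAll Xs D u v ≡ converse D u v) →
               ∀ {u v} → Adjacent G u v → Any (λ X → T (covers X u v)) Xs
edge-covered {D = D} orients Xs reverses {u} {v} uv =
  changed⇒covered D Xs (λ same → orientation-asym orients uv (≡.trans (≡.sym same) (reverses u v)))

skipFirstLeg : ∀ {m} → Fin (suc m) → Fin (3 + m)
skipFirstLeg zero    = zero
skipFirstLeg (suc k) = suc (suc (suc k))

-- Vertex 0 is the centre and vertices 2i+1, 2i+2 form a leg, 2i+1 being adjacent to the centre;
-- for odd m the last leg is the single vertex m.
spiderParent : ∀ {m} → Fin m → Fin (suc m)
spiderParent zero          = zero
spiderParent (suc zero)    = suc zero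
spiderParent (suc (suc j)) = skipFirstLeg (spiderParent j)

skipFirstLeg-< : ∀ {m} {k : Fin (suc m)} {j : Fin m} → k < suc j → skipFirstLeg k < suc (suc (suc j))
skipFirstLeg-< {k = zero}  _   = z<s
skipFirstLeg-< {k = suc _} k<j = s<s (s<s k<j)

spiderParent<child : ∀ {m} (j : Fin m) → spiderParent j < suc j
spiderParent<child zero          = z<s
spiderParent<child (suc zero)    = s<s z<s
spiderParent<child (suc (suc j)) = skipFirstLeg-< (spiderParent<child j)

spider : ∀ m → Graph (suc m)
spider m = RecursiveTree.tree (spiderParent {m}) spiderParent<child

spider-isTree : ∀ m → IsTree (spider m)
spider-isTree m = RecursiveTree.isTree (spiderParent {m}) spiderParent<child

dropFirstLeg : ∀ {m} → Subset (3 + m) → Subset (suc m)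
dropFirstLeg (c ∷ _ ∷ _ ∷ Y) = c ∷ Y

inversionWeight : ∀ {m} → Subset (suc m) → ℕ
inversionWeight {zero}        _ = 0
inversionWeight {suc zero}    X = if covers X zero (suc zero) then 1 else 0
inversionWeight {suc (suc m)} X = (if covers X zero (suc zero) then 1 else 0)
                                + (if covers X (suc zero) (suc (suc zero)) then 2 else 0)
                                + inversionWeight (dropFirstLeg X)

totalEdgeWeight : ℕ → ℕ
totalEdgeWeight zero          = 0
totalEdgeWeight (suc zero)    = 1
totalEdgeWeight (suc (suc m)) = 3 + totalEdgeWeight m

sum-map-+ : ∀ {A : Set} (f g : A → ℕ) xs → sum (map (λ x → f x + g x) xs) ≡ sum (map f xs) + sum (map g xs)
sum-map-+ f g []       = refl
sum-map-+ f g (x ∷ xs) = ≡.trans (cong (f x + g x +_) (sum-map-+ f g xs)) (interchange (f x) (g x) _ _)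

Any⇒≤sum : ∀ {A : Set} {P : A → Set} {f : A → ℕ} {k xs} → Any P xs → (∀ {x} → P x → k ≤ f x) →
           k ≤ sum (map f xs)
Any⇒≤sum {f = f} (here  {x} p) k≤f = ≤-trans (k≤f p) (m≤m+n (f x) _)
Any⇒≤sum {f = f} (there {x} a) k≤f = ≤-trans (Any⇒≤sum a k≤f) (m≤n+m _ (f x))

All⇒sum≤ : ∀ {A : Set} {f : A → ℕ} {k xs} → All (λ x → f x ≤ k) xs → sum (map f xs) ≤ length xs * k
All⇒sum≤ []       = z≤n
All⇒sum≤ (p ∷ ps) = +-mono-≤ p (All⇒sum≤ ps)

≤-if : ∀ {b k} → T b → k ≤ (if b then k else 0)
≤-if {true} _ = ≤-refl

lookup-skipFirstLeg : ∀ {m} (X : Subset (3 + m)) k → lookup X (skipFirstLeg k) ≡ lookup (dropFirstLeg X) k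
lookup-skipFirstLeg (_ ∷ _ ∷ _ ∷ _) zero    = refl
lookup-skipFirstLeg (_ ∷ _ ∷ _ ∷ _) (suc _) = refl

covers-dropFirstLeg : ∀ {m} (X : Subset (3 + m)) j →
                      T (covers X (spiderParent (suc (suc j))) (suc (suc (suc j)))) →
                      T (covers (dropFirstLeg X) (spiderParent j) (suc j))
covers-dropFirstLeg X@(_ ∷ _ ∷ _ ∷ Y) j =
  subst (λ b → T (b ∧ lookup Y j)) (lookup-skipFirstLeg X (spiderParent j))

totalEdgeWeight≤sum : ∀ m (Xs : List (Subset (suc m))) →
                      (∀ j → Any (λ X → T (covers X (spiderParent j) (suc j))) Xs) →
                      totalEdgeWeight m ≤ sum (map inversionWeight Xs)
totalEdgeWeight≤sum zero          _  _       = z≤n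
totalEdgeWeight≤sum (suc zero)    _  covered = Any⇒≤sum (covered zero) ≤-if
totalEdgeWeight≤sum (suc (suc m)) Xs covered = begin
  1 + 2 + totalEdgeWeight m
    ≤⟨ +-mono-≤ (+-mono-≤ (Any⇒≤sum (covered zero) ≤-if) (Any⇒≤sum (covered (suc zero)) ≤-if))
                (totalEdgeWeight≤sum m (map dropFirstLeg Xs) covered-after-drop) ⟩
  sum (map inner Xs) + sum (map outer Xs) + sum (map inversionWeight (map dropFirstLeg Xs))
    ≡⟨ cong₂ _+_ (≡.sym (sum-map-+ inner outer Xs)) (cong sum (≡.sym (map-∘ Xs))) ⟩
  sum (map (λ X → inner X + outer X) Xs) + sum (map (inversionWeight ∘ dropFirstLeg) Xs)
    ≡⟨ ≡.sym (sum-map-+ (λ X → inner X + outer X) (inversionWeight ∘ dropFirstLeg) Xs) ⟩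
  sum (map inversionWeight Xs) ∎
  where
  open ≤-Reasoning
  inner outer : Subset (3 + m) → ℕ
  inner X = if covers X zero (suc zero) then 1 else 0
  outer X = if covers X (suc zero) (suc (suc zero)) then 2 else 0
  covered-after-drop : ∀ j → Any (λ X → T (covers X (spiderParent j) (suc j))) (map dropFirstLeg Xs)
  covered-after-drop j = Any.map⁺ (Any.map (λ {X} → covers-dropFirstLeg X j) (covered (suc (suc j))))

scaled-+-mono-≤ : ∀ {k l} x y {w s} → k * x ≤ l * y → k * w ≤ l * s → k * (x + w) ≤ l * (y + s)
scaled-+-mono-≤ {k} {l} x y {w} {s} p q
  rewrite *-distribˡ-+ k x w | *-distribˡ-+ l y s = +-mono-≤ p q

inversionWeight-rootless : ∀ {m} (Y : Subset m) → inversionWeight (false ∷ Y) ≤ ∣ Y ∣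
inversionWeight-rootless []                  = z≤n
inversionWeight-rootless (_ ∷ [])            = z≤n
inversionWeight-rootless (true  ∷ true  ∷ Y) = s≤s (s≤s (inversionWeight-rootless Y))
inversionWeight-rootless (true  ∷ false ∷ Y) = m≤n⇒m≤1+n (inversionWeight-rootless Y)
inversionWeight-rootless (false ∷ true  ∷ Y) = m≤n⇒m≤1+n (inversionWeight-rootless Y)
inversionWeight-rootless (false ∷ false ∷ Y) = inversionWeight-rootless Y

inversionWeight-rooted : ∀ {m} (Y : Subset m) → 2 * inversionWeight (true ∷ Y) ≤ 3 * ∣ Y ∣
inversionWeight-rooted []                  = z≤n
inversionWeight-rooted (true  ∷ [])        = n≤1+n 2
inversionWeight-rooted (false ∷ [])        = z≤n
inversionWeight-rooted (true  ∷ true  ∷ Y) = scaled-+-mono-≤ {2} {3} 3 2 ≤-refl (inversionWeight-rooted Y)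
inversionWeight-rooted (true  ∷ false ∷ Y) = scaled-+-mono-≤ {2} {3} 1 1 (n≤1+n 2) (inversionWeight-rooted Y)
inversionWeight-rooted (false ∷ true  ∷ Y) = ≤-trans (inversionWeight-rooted Y) (*-monoʳ-≤ 3 (n≤1+n _))
inversionWeight-rooted (false ∷ false ∷ Y) = inversionWeight-rooted Y

inversionWeight≤4 : ∀ {m} (X : Subset (suc m)) → ∣ X ∣ ≤ 4 → inversionWeight X ≤ 4
inversionWeight≤4 (false ∷ Y) |X|≤4       = ≤-trans (inversionWeight-rootless Y) |X|≤4
inversionWeight≤4 (true  ∷ Y) (s≤s |Y|≤3) =
  ≤-pred (*-cancelˡ-< 2 _ 5 (s≤s (≤-trans (inversionWeight-rooted Y) (*-monoʳ-≤ 3 |Y|≤3))))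

3*[1+m]≤4+2*totalEdgeWeight : ∀ m → 3 * suc m ≤ 4 + 2 * totalEdgeWeight m
3*[1+m]≤4+2*totalEdgeWeight zero          = n≤1+n 3
3*[1+m]≤4+2*totalEdgeWeight (suc zero)    = ≤-refl
3*[1+m]≤4+2*totalEdgeWeight (suc (suc m)) = begin
  3 * (3 + m)                     ≡⟨ expand m ⟩
  6 + 3 * suc m                   ≤⟨ +-monoʳ-≤ 6 (3*[1+m]≤4+2*totalEdgeWeight m) ⟩
  6 + (4 + 2 * totalEdgeWeight m) ≡⟨ regroup (totalEdgeWeight m) ⟩
  4 + 2 * (3 + totalEdgeWeight m) ∎
  where
  open ≤-Reasoning
  expand : ∀ m → 3 * (3 + m) ≡ 6 + 3 * suc m
  expand = solve-∀
  regroup : ∀ w → 6 + (4 + 2 * w) ≡ 4 + 2 * (3 + w)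
  regroup = solve-∀

m≤n*[1+d]⇒[m+d]/[1+d]≤n : ∀ {m n} d → m ≤ n * suc d → (m + d) / suc d ≤ n
m≤n*[1+d]⇒[m+d]/[1+d]≤n {m} {n} d m≤n*[1+d] = ≤-pred (m<n*o⇒m/o<n (begin-strict
  m + d          ≡⟨ +-comm m d ⟩
  d + m          <⟨ +-mono-<-≤ (n<1+n d) m≤n*[1+d] ⟩
  suc n * suc d  ∎))
  where open ≤-Reasoning

totalEdgeWeight≤k*4⇒bound≤k : ∀ m k → totalEdgeWeight m ≤ k * 4 → bound (suc m) ≤ k
totalEdgeWeight≤k*4⇒bound≤k m k W≤k*4 = m≤n*[1+d]⇒[m+d]/[1+d]≤n 7 (begin
  3 * suc m ∸ 4          ≤⟨ m≤n+o⇒m∸n≤o (3 * suc m) 4 (3*[1+m]≤4+2*totalEdgeWeight m) ⟩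
  2 * totalEdgeWeight m  ≤⟨ *-monoʳ-≤ 2 W≤k*4 ⟩
  2 * (k * 4)            ≡⟨ regroup k ⟩
  k * 8                  ∎)
  where
  open ≤-Reasoning
  regroup : ∀ k → 2 * (k * 4) ≡ k * 8
  regroup = solve-∀

proposition24 : (n : ℕ) → 1 ≤ n → Σ (Graph n) (λ T → IsTree T × ConvAtLeast 4 T (bound n))
proposition24 (suc m) _ = spider m , spider-isTree m , λ D orients Xs small reverses →
  totalEdgeWeight≤k*4⇒bound≤k m (length Xs) (begin
    totalEdgeWeight m
      ≤⟨ totalEdgeWeight≤sum m Xs (λ j → edge-covered orients Xs reverses (parent-adjacent j)) ⟩
    sum (map inversionWeight Xs)
      ≤⟨ All⇒sum≤ (All.map (λ {X} → inversionWeight≤4 X) small) ⟩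
    length Xs * 4 ∎)
  where
  open ≤-Reasoning
  open RecursiveTree (spiderParent {m}) spiderParent<child using (parent-adjacent)
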